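{- Let $\Delta$ be a pure strongly shellable simplicial complex on the vertex set $[n]$ and let $\mathbb{K}$ be a field. Then the facet ideal $I(\Delta)=\langle \mathbf{x}^F \mid F\in\mathcal{F}(\Delta)\rangle\subseteq \mathbb{K}[x_1,\dots,x_n]$, where $\mathbf{x}^F=\prod_{i\in F}x_i$, has linear quotients.
   Context: A simplicial complex $\Delta$ is a finite family of subsets of a vertex set closed under taking subsets; $\mathcal{F}(\Delta)$ is its set of facets, $\dim(A)=|A|-1$; $\Delta$ is pure if all facets have the same dimension. A linear order $F_1,\dots,F_t$ of $\mathcal{F}(\Delta)$ is a strong shelling order if for every $1\le i<j\le t$ there exists $k$ with $1\le k<j$ such that $|F_j\setminus F_k|=1$, $F_j\setminus F_k\subseteq F_j\setminus F_i$, and $F_k\setminus F_j\subseteq F_i$; $\Delta$ is strongly shellable if such an order exists. A graded ideal $I$ of a polynomial ring has linear quotients if there is a system of homogeneous generators $f_1,\dots,f_m$ of $I$ such that the colon ideal $\langle f_1,\dots,f_{i-1}\rangle : f_i$ is generated by linear forms for all $i$. -}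

module Defs where

open import Level using (Level; _⊔_) renaming (suc to lsuc)
open import Algebra.Bundles using (CommutativeRing)
open import Data.Nat as ℕ using (ℕ; zero; suc; _<_)
open import Data.Bool using (Bool; true; false)
open import Data.Fin as Fin using (Fin; toℕ)
open import Data.Fin.Subset as S using (Subset; _⊆_; _─_; ∣_∣)
open import Data.Vec as Vec using (Vec)
open import Data.Vec.Properties using (≡-dec)
open import Data.List as List using (List; []; _∷_; _++_; length; lookup; take; concatMap; zipWith)
open import Data.List.Membership.Propositional as LM using ()
open import Data.List.Relation.Unary.All using (All)
open import Data.List.Relation.Unary.Unique.Propositional using (Unique)
open import Data.Product using (Σ; ∃; ∃-syntax; _×_; _,_)
open import Relation.Nullary using (¬_; yes; no)
open import Relation.Binary.PropositionalEquality using (_≡_)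
open import Function.Bundles using (_⇔_)

record Field (c ℓ : Level) : Set (lsuc (c ⊔ ℓ)) where
  field
    commutativeRing : CommutativeRing c ℓ
  open CommutativeRing commutativeRing public
  field
    1≉0     : ¬ (1# ≈ 0#)
    inverse : ∀ x → ¬ (x ≈ 0#) → ∃[ y ] (x * y ≈ 1#)

record SimplicialComplex (n : ℕ) : Set where
  field
    faces      : List (Subset n)
    downClosed : ∀ {A B} → A LM.∈ faces → B ⊆ A → B LM.∈ faces
open SimplicialComplex public

IsFacet : ∀ {n} → SimplicialComplex n → Subset n → Set
IsFacet Δ F = F LM.∈ faces Δ × (∀ G → G LM.∈ faces Δ → F ⊆ G → G ≡ F)

Pure : ∀ {n} → SimplicialComplex n → Set
Pure Δ = ∀ F G → IsFacet Δ F → IsFacet Δ G → ∣ F ∣ ≡ ∣ G ∣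

IsFacetOrder : ∀ {n} → SimplicialComplex n → List (Subset n) → Set
IsFacetOrder Δ L = Unique L × (∀ F → (F LM.∈ L) ⇔ IsFacet Δ F)

IsStrongShellingOrder : ∀ {n} → SimplicialComplex n → List (Subset n) → Set
IsStrongShellingOrder Δ L =
  IsFacetOrder Δ L ×
  (∀ (i j : Fin (length L)) → toℕ i < toℕ j →
     ∃[ k ] (toℕ k < toℕ j ×
       ∣ lookup L j ─ lookup L k ∣ ≡ 1 ×
       (lookup L j ─ lookup L k) ⊆ (lookup L j ─ lookup L i) ×
       (lookup L k ─ lookup L j) ⊆ lookup L i))

StronglyShellable : ∀ {n} → SimplicialComplex n → Set
StronglyShellable Δ = ∃[ L ] IsStrongShellingOrder Δ L

-- The polynomial ring K[x_1,...,x_n]: a polynomial is a finite formal sum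
-- of terms c·x^α (α ∈ ℕ^n); two polynomials are equal iff every monomial
-- has the same (summed) coefficient.

module Poly {c ℓ} (K : Field c ℓ) (n : ℕ) where
  open Field K

  Exp : Set
  Exp = Vec ℕ n

  Term : Set c
  Term = Carrier × Exp

  Pol : Set c
  Pol = List Term

  coeff : Pol → Exp → Carrier
  coeff []             α = 0#
  coeff ((a , β) ∷ p) α with ≡-dec ℕ._≟_ β α
  ... | yes _ = a + coeff p α
  ... | no  _ = coeff p α

  infix 4 _≈ₚ_
  _≈ₚ_ : Pol → Pol → Set ℓ
  p ≈ₚ q = ∀ α → coeff p α ≈ coeff q α

  0ₚ : Pol
  0ₚ = []

  _+ₚ_ : Pol → Pol → Pol
  p +ₚ q = p ++ q

  _*ₚ_ : Pol → Pol → Pol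
  p *ₚ q = concatMap (λ { (a , α) → List.map (λ { (b , β) → (a * b , Vec.zipWith ℕ._+_ α β) }) q }) p

  sumₚ : List Pol → Pol
  sumₚ = List.foldr _+ₚ_ 0ₚ

  degree : Exp → ℕ
  degree = Vec.foldr _ ℕ._+_ 0

  IsHomogeneous : Pol → Set ℓ
  IsHomogeneous p = ∃[ d ] (∀ α → ¬ (coeff p α ≈ 0#) → degree α ≡ d)

  IsLinearForm : Pol → Set ℓ
  IsLinearForm p = ∀ α → ¬ (coeff p α ≈ 0#) → degree α ≡ 1

  _∈⟨_⟩ : Pol → List Pol → Set (c ⊔ ℓ)
  f ∈⟨ gs ⟩ = ∃[ hs ] (length hs ≡ length gs × f ≈ₚ sumₚ (zipWith _*ₚ_ hs gs))

  xmon : Subset n → Pol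
  xmon F = (1# , Vec.map (λ { true → 1 ; false → 0 }) F) ∷ []

  InFacetIdeal : SimplicialComplex n → Pol → Set (c ⊔ ℓ)
  InFacetIdeal Δ g = ∃[ Fs ] (All (IsFacet Δ) Fs × g ∈⟨ List.map xmon Fs ⟩)

  HasLinearQuotients : (Pol → Set (c ⊔ ℓ)) → Set (c ⊔ ℓ)
  HasLinearQuotients I =
    ∃[ fs ] (All IsHomogeneous fs ×
             (∀ g → (g ∈⟨ fs ⟩) ⇔ I g) ×
             (∀ (i : Fin (length fs)) →
                ∃[ ls ] (All IsLinearForm ls ×
                  (∀ g → (g ∈⟨ ls ⟩) ⇔ ((g *ₚ lookup fs i) ∈⟨ take (toℕ i) fs ⟩)))))

-- A polynomial lies in a monomial ideal ⟨x^e | e ∈ E⟩ exactly when every monomial in its support is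
-- divisible by some x^e; consequently ⟨x^F₁, …, x^Fⱼ₋₁⟩ : x^Fⱼ is the monomial ideal of all x^β with
-- x^Fᵢ ∣ x^β x^Fⱼ for some i < j, i.e. with x^(Fᵢ ─ Fⱼ) ∣ x^β.  For such i the strong shelling order
-- supplies k < j with Fⱼ ─ Fₖ a single vertex and Fₖ ─ Fⱼ ⊆ Fᵢ, so x^(Fₖ ─ Fⱼ) ∣ x^(Fᵢ ─ Fⱼ); hence the
-- colon is generated by the x^(Fₖ ─ Fⱼ) for these adjacent facets, and purity makes each one a variable.

module Submission where

open import Defs
open import Level using (Level; _⊔_)
open import Data.Nat as ℕ using (ℕ; suc; _+_; _∸_; _≤_; _<_; z≤n; s≤s)
open import Data.Nat.Properties using (m≤n+m; m≤m+n; m∸n+n≡m; +-cancelʳ-≡; +-suc; ≤-trans)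
import Data.Nat.Properties as ℕₚ
open import Data.Bool using (Bool; true; false)
open import Data.Fin as Fin using (Fin; toℕ)
open import Data.Fin.Subset using (Subset; _⊆_; _─_; ∣_∣)
open import Data.Fin.Subset.Properties using (drop-∷-⊆)
open import Data.Vec as Vec using (Vec; []; _∷_)
open import Data.Vec.Properties using (≡-dec; ∷-injectiveˡ; ∷-injectiveʳ)
import Data.Vec.Properties as Vecₚ
open import Data.Vec.Relation.Binary.Pointwise.Inductive as Pointwise using (Pointwise; []; _∷_)
open import Data.List as List using (List; []; _∷_; _++_; length; lookup; take; filter; zipWith)
import Data.List.Properties as Listₚ
open import Data.List.Membership.Propositional using (_∈_; find; lose)
open import Data.List.Membership.Propositional.Properties using (∈-map⁺; ∈-filter⁺; ∈-filter⁻; ∈-lookup)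
open import Data.List.Relation.Unary.Any using (Any; here; there; any?)
import Data.List.Relation.Unary.Any.Properties as Anyₚ
open import Data.List.Relation.Unary.All as All using (All; []; _∷_)
import Data.List.Relation.Unary.All.Properties as Allₚ
open import Data.List.Relation.Binary.Subset.Propositional.Properties using (Any-resp-⊆)
open import Data.Product using (∃-syntax; _×_; _,_; proj₁; proj₂)
open import Relation.Nullary using (¬_; yes; no; Dec; contradiction)
open import Relation.Unary using (Decidable)
open import Relation.Binary.PropositionalEquality using (_≡_; refl; sym; trans; cong; cong₂; subst)
open import Function using (_∘_)
open import Function.Bundles using (_⇔_; mk⇔; Equivalence)
import Function.Properties.Equivalence as ⇔

module _ {k : ℕ} where

  infix 4 _≤ₑ_
  infixl 6 _+ₑ_ _∸ₑ_

  _≤ₑ_ : Vec ℕ k → Vec ℕ k → Set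
  _≤ₑ_ = Pointwise _≤_

  _≤ₑ?_ : (α β : Vec ℕ k) → Dec (α ≤ₑ β)
  _≤ₑ?_ = Pointwise.decidable ℕ._≤?_

  _+ₑ_ : Vec ℕ k → Vec ℕ k → Vec ℕ k
  _+ₑ_ = Vec.zipWith _+_

  _∸ₑ_ : Vec ℕ k → Vec ℕ k → Vec ℕ k
  _∸ₑ_ = Vec.zipWith _∸_

n≤ₑm+ₑn : ∀ {k} (α β : Vec ℕ k) → β ≤ₑ α +ₑ β
n≤ₑm+ₑn [] [] = []
n≤ₑm+ₑn (x ∷ α) (y ∷ β) = m≤n+m y x ∷ n≤ₑm+ₑn α β

m∸ₑn+ₑn≡m : ∀ {k} {α β : Vec ℕ k} → β ≤ₑ α → α ∸ₑ β +ₑ β ≡ α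
m∸ₑn+ₑn≡m [] = refl
m∸ₑn+ₑn≡m (y≤x ∷ β≤α) = cong₂ _∷_ (m∸n+n≡m y≤x) (m∸ₑn+ₑn≡m β≤α)

+ₑ-cancelʳ-≡ : ∀ {k} (α β γ : Vec ℕ k) → α +ₑ γ ≡ β +ₑ γ → α ≡ β
+ₑ-cancelʳ-≡ [] [] [] _ = refl
+ₑ-cancelʳ-≡ (x ∷ α) (y ∷ β) (z ∷ γ) eq =
  cong₂ _∷_ (+-cancelʳ-≡ z x y (∷-injectiveˡ eq)) (+ₑ-cancelʳ-≡ α β γ (∷-injectiveʳ eq))

bit : Bool → ℕ
bit true  = 1
bit false = 0

χ : ∀ {k} → Subset k → Vec ℕ k
χ = Vec.map bit

sum-χ : ∀ {k} (A : Subset k) → Vec.foldr _ _+_ 0 (χ A) ≡ ∣ A ∣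
sum-χ [] = refl
sum-χ (true ∷ A) = cong suc (sum-χ A)
sum-χ (false ∷ A) = sum-χ A

χ-─-≤ₑ : ∀ {k} (A B C : Subset k) (β : Vec ℕ k) → C ─ B ⊆ A → χ A ≤ₑ β +ₑ χ B → χ (C ─ B) ≤ₑ β
χ-─-≤ₑ [] [] [] [] _ _ = []
χ-─-≤ₑ (a ∷ A) (true ∷ B) (c ∷ C) (x ∷ β) sub (_ ∷ le) =
  z≤n ∷ χ-─-≤ₑ A B C β (drop-∷-⊆ sub) le
χ-─-≤ₑ (a ∷ A) (false ∷ B) (false ∷ C) (x ∷ β) sub (_ ∷ le) =
  z≤n ∷ χ-─-≤ₑ A B C β (drop-∷-⊆ sub) le
χ-─-≤ₑ (false ∷ A) (false ∷ B) (true ∷ C) (x ∷ β) sub _ with sub Vec.here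
... | ()
χ-─-≤ₑ (true ∷ A) (false ∷ B) (true ∷ C) (x ∷ β) sub (1≤x+0 ∷ le) =
  subst (1 ≤_) (ℕₚ.+-identityʳ x) 1≤x+0 ∷ χ-─-≤ₑ A B C β (drop-∷-⊆ sub) le

χ-≤ₑ-+ₑχ : ∀ {k} (A B : Subset k) (β : Vec ℕ k) → χ (A ─ B) ≤ₑ β → χ A ≤ₑ β +ₑ χ B
χ-≤ₑ-+ₑχ [] [] [] _ = []
χ-≤ₑ-+ₑχ (true ∷ A) (true ∷ B) (x ∷ β) (_ ∷ le) = m≤n+m 1 x ∷ χ-≤ₑ-+ₑχ A B β le
χ-≤ₑ-+ₑχ (true ∷ A) (false ∷ B) (x ∷ β) (1≤x ∷ le) =
  ≤-trans 1≤x (m≤m+n x 0) ∷ χ-≤ₑ-+ₑχ A B β le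
χ-≤ₑ-+ₑχ (false ∷ A) (b ∷ B) (x ∷ β) (_ ∷ le) = z≤n ∷ χ-≤ₑ-+ₑχ A B β le

∣p─q∣+∣q∣≡∣q─p∣+∣p∣ : ∀ {k} (p q : Subset k) → ∣ p ─ q ∣ + ∣ q ∣ ≡ ∣ q ─ p ∣ + ∣ p ∣
∣p─q∣+∣q∣≡∣q─p∣+∣p∣ [] [] = refl
∣p─q∣+∣q∣≡∣q─p∣+∣p∣ (true ∷ p) (true ∷ q) =
  trans (+-suc _ _) (trans (cong suc (∣p─q∣+∣q∣≡∣q─p∣+∣p∣ p q)) (sym (+-suc _ _)))
∣p─q∣+∣q∣≡∣q─p∣+∣p∣ (true ∷ p) (false ∷ q) =
  trans (cong suc (∣p─q∣+∣q∣≡∣q─p∣+∣p∣ p q)) (sym (+-suc _ _))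
∣p─q∣+∣q∣≡∣q─p∣+∣p∣ (false ∷ p) (true ∷ q) =
  trans (+-suc _ _) (cong suc (∣p─q∣+∣q∣≡∣q─p∣+∣p∣ p q))
∣p─q∣+∣q∣≡∣q─p∣+∣p∣ (false ∷ p) (false ∷ q) = ∣p─q∣+∣q∣≡∣q─p∣+∣p∣ p q

∣p─q∣≡1⇒∣q─p∣≡1 : ∀ {k} (p q : Subset k) → ∣ q ∣ ≡ ∣ p ∣ → ∣ p ─ q ∣ ≡ 1 → ∣ q ─ p ∣ ≡ 1
∣p─q∣≡1⇒∣q─p∣≡1 p q ∣q∣≡∣p∣ ∣p─q∣≡1 = sym (+-cancelʳ-≡ (∣ p ∣) 1 (∣ q ─ p ∣)
  (trans (cong₂ _+_ (sym ∣p─q∣≡1) (sym ∣q∣≡∣p∣)) (∣p─q∣+∣q∣≡∣q─p∣+∣p∣ p q)))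

module _ {a} {A : Set a} where

  lookup-map : ∀ {b} {B : Set b} (f : A → B) (xs : List A) (i : Fin (length (List.map f xs))) →
               ∃[ j ] (toℕ j ≡ toℕ i × lookup (List.map f xs) i ≡ f (lookup xs j))
  lookup-map f (x ∷ xs) Fin.zero = Fin.zero , refl , refl
  lookup-map f (x ∷ xs) (Fin.suc i) with lookup-map f xs i
  ... | j , j≡i , eq = Fin.suc j , cong suc j≡i , eq

  ∈-take⇒lookup : ∀ (xs : List A) j {x} → x ∈ take j xs → ∃[ i ] (toℕ i < j × lookup xs i ≡ x)
  ∈-take⇒lookup (y ∷ xs) (suc j) (here x≡y) = Fin.zero , s≤s z≤n , sym x≡y
  ∈-take⇒lookup (y ∷ xs) (suc j) (there x∈) with ∈-take⇒lookup xs j x∈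
  ... | i , i<j , eq = Fin.suc i , s≤s i<j , eq

  lookup∈take : ∀ (xs : List A) j (i : Fin (length xs)) → toℕ i < j → lookup xs i ∈ take j xs
  lookup∈take (x ∷ xs) (suc j) Fin.zero _ = here refl
  lookup∈take (x ∷ xs) (suc j) (Fin.suc i) (s≤s i<j) = there (lookup∈take xs j i i<j)

module MonomialIdeals {c ℓ} (K : Field c ℓ) (n : ℕ) where
  open Field K renaming (_+_ to _⊕_; refl to ≈-refl; sym to ≈-sym; trans to ≈-trans)
  open Poly K n
  open import Relation.Binary.Reasoning.Setoid setoid

  monomial : Exp → Pol
  monomial e = (1# , e) ∷ []

  Multiple : List Exp → Exp → Set
  Multiple es β = Any (_≤ₑ β) es

  SupportedOn : (Exp → Set) → Pol → Set ℓ
  SupportedOn P p = ∀ β → ¬ P β → coeff p β ≈ 0#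

  combination : List Pol → List Exp → Pol
  combination hs es = sumₚ (zipWith _*ₚ_ hs (List.map monomial es))

  coeff-∷-≡ : ∀ {a α p β} → α ≡ β → coeff ((a , α) ∷ p) β ≈ a ⊕ coeff p β
  coeff-∷-≡ {α = α} {β = β} α≡β with ≡-dec ℕ._≟_ α β
  ... | yes _   = ≈-refl
  ... | no  α≢β = contradiction α≡β α≢β

  coeff-∷-≢ : ∀ {a α p β} → ¬ α ≡ β → coeff ((a , α) ∷ p) β ≈ coeff p β
  coeff-∷-≢ {α = α} {β = β} α≢β with ≡-dec ℕ._≟_ α β
  ... | yes α≡β = contradiction α≡β α≢β
  ... | no  _   = ≈-refl

  coeff-∷-cong : ∀ {a b α α′} p q β → α ≡ α′ → a ≈ b → coeff p β ≈ coeff q β →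
                 coeff ((a , α) ∷ p) β ≈ coeff ((b , α′) ∷ q) β
  coeff-∷-cong {α = α} p q β refl a≈b p≈q with ≡-dec ℕ._≟_ α β
  ... | yes _ = +-cong a≈b p≈q
  ... | no  _ = p≈q

  coeff-++ : ∀ p q β → coeff (p ++ q) β ≈ coeff p β ⊕ coeff q β
  coeff-++ [] q β = ≈-sym (+-identityˡ _)
  coeff-++ ((a , α) ∷ p) q β with ≡-dec ℕ._≟_ α β
  ... | yes _ = ≈-trans (+-cong ≈-refl (coeff-++ p q β)) (≈-sym (+-assoc _ _ _))
  ... | no  _ = coeff-++ p q β

  support-monomial : ∀ e α → ¬ coeff (monomial e) α ≈ 0# → e ≡ α
  support-monomial e α nonzero with ≡-dec ℕ._≟_ e α
  ... | yes e≡α = e≡α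
  ... | no  _   = contradiction ≈-refl nonzero

  monomial-homogeneous : ∀ e → IsHomogeneous (monomial e)
  monomial-homogeneous e = degree e , λ α nonzero → cong degree (sym (support-monomial e α nonzero))

  monomial-linear : ∀ e → degree e ≡ 1 → IsLinearForm (monomial e)
  monomial-linear e deg≡1 α nonzero = trans (cong degree (sym (support-monomial e α nonzero))) deg≡1

  coeff-*monomial : ∀ p e β → coeff (p *ₚ monomial e) (β +ₑ e) ≈ coeff p β
  coeff-*monomial [] e β = ≈-refl
  coeff-*monomial ((a , α) ∷ p) e β with ≡-dec ℕ._≟_ α β
  ... | yes α≡β = ≈-trans (coeff-∷-≡ (cong (_+ₑ e) α≡β)) (+-cong (*-identityʳ a) (coeff-*monomial p e β))
  ... | no  α≢β = ≈-trans (coeff-∷-≢ (α≢β ∘ +ₑ-cancelʳ-≡ α β e)) (coeff-*monomial p e β)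

  coeff-*monomial-≰ : ∀ p e β → ¬ e ≤ₑ β → coeff (p *ₚ monomial e) β ≈ 0#
  coeff-*monomial-≰ [] e β _ = ≈-refl
  coeff-*monomial-≰ ((a , α) ∷ p) e β e≰β =
    ≈-trans (coeff-∷-≢ (λ α+e≡β → e≰β (subst (e ≤ₑ_) α+e≡β (n≤ₑm+ₑn α e))))
            (coeff-*monomial-≰ p e β e≰β)

  coeff-combination-≰ : ∀ hs es β → ¬ Multiple es β → coeff (combination hs es) β ≈ 0#
  coeff-combination-≰ [] es β _ = ≈-refl
  coeff-combination-≰ (h ∷ hs) [] β _ = ≈-refl
  coeff-combination-≰ (h ∷ hs) (e ∷ es) β ¬mult = begin
    coeff (combination (h ∷ hs) (e ∷ es)) β
      ≈⟨ coeff-++ (h *ₚ monomial e) (combination hs es) β ⟩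
    coeff (h *ₚ monomial e) β ⊕ coeff (combination hs es) β
      ≈⟨ +-cong (coeff-*monomial-≰ h e β (¬mult ∘ here)) (coeff-combination-≰ hs es β (¬mult ∘ there)) ⟩
    0# ⊕ 0#
      ≈⟨ +-identityˡ 0# ⟩
    0# ∎

  quotient : Exp → Pol → Pol
  quotient e [] = []
  quotient e ((a , α) ∷ p) with e ≤ₑ? α
  ... | yes _ = (a , α ∸ₑ e) ∷ quotient e p
  ... | no  _ = quotient e p

  remainder : Exp → Pol → Pol
  remainder e [] = []
  remainder e ((a , α) ∷ p) with e ≤ₑ? α
  ... | yes _ = remainder e p
  ... | no  _ = (a , α) ∷ remainder e p

  coeff-quotient : ∀ e p β → e ≤ₑ β → coeff (quotient e p *ₚ monomial e) β ≈ coeff p β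
  coeff-quotient e [] β _ = ≈-refl
  coeff-quotient e ((a , α) ∷ p) β e≤β with e ≤ₑ? α
  ... | yes e≤α = coeff-∷-cong (quotient e p *ₚ monomial e) p β
                    (m∸ₑn+ₑn≡m e≤α) (*-identityʳ a) (coeff-quotient e p β e≤β)
  ... | no  e≰α = ≈-trans (coeff-quotient e p β e≤β)
                          (≈-sym (coeff-∷-≢ (λ α≡β → e≰α (subst (e ≤ₑ_) (sym α≡β) e≤β))))

  coeff-remainder-≤ : ∀ e p β → e ≤ₑ β → coeff (remainder e p) β ≈ 0#
  coeff-remainder-≤ e [] β _ = ≈-refl
  coeff-remainder-≤ e ((a , α) ∷ p) β e≤β with e ≤ₑ? α
  ... | yes _   = coeff-remainder-≤ e p β e≤β
  ... | no  e≰α = ≈-trans (coeff-∷-≢ (λ α≡β → e≰α (subst (e ≤ₑ_) (sym α≡β) e≤β)))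
                          (coeff-remainder-≤ e p β e≤β)

  coeff-remainder-≰ : ∀ e p β → ¬ e ≤ₑ β → coeff (remainder e p) β ≈ coeff p β
  coeff-remainder-≰ e [] β _ = ≈-refl
  coeff-remainder-≰ e ((a , α) ∷ p) β e≰β with e ≤ₑ? α
  ... | yes e≤α = ≈-trans (coeff-remainder-≰ e p β e≰β)
                          (≈-sym (coeff-∷-≢ (λ α≡β → e≰β (subst (e ≤ₑ_) α≡β e≤α))))
  ... | no  _   = coeff-∷-cong {a = a} {α = α} (remainder e p) p β
                    refl ≈-refl (coeff-remainder-≰ e p β e≰β)

  cofactors : Pol → List Exp → List Pol
  cofactors p [] = []
  cofactors p (e ∷ es) = quotient e p ∷ cofactors (remainder e p) es

  length-cofactors : ∀ p es → length (cofactors p es) ≡ length (List.map monomial es)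
  length-cofactors p [] = refl
  length-cofactors p (e ∷ es) = cong suc (length-cofactors (remainder e p) es)

  coeff-combination-cofactors : ∀ es p β → Multiple es β →
                                coeff (combination (cofactors p es) es) β ≈ coeff p β
  coeff-combination-cofactors (e ∷ es) p β _ with e ≤ₑ? β
  coeff-combination-cofactors (e ∷ es) p β _ | yes e≤β = begin
    coeff (quotient e p *ₚ monomial e ++ combination (cofactors (remainder e p) es) es) β
      ≈⟨ coeff-++ (quotient e p *ₚ monomial e) _ β ⟩
    coeff (quotient e p *ₚ monomial e) β ⊕ coeff (combination (cofactors (remainder e p) es) es) β
      ≈⟨ +-cong (coeff-quotient e p β e≤β) later≈0 ⟩
    coeff p β ⊕ 0#
      ≈⟨ +-identityʳ _ ⟩
    coeff p β ∎
    where
    later≈0 : coeff (combination (cofactors (remainder e p) es) es) β ≈ 0#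
    later≈0 with any? (_≤ₑ? β) es
    ... | yes mult = ≈-trans (coeff-combination-cofactors es (remainder e p) β mult)
                             (coeff-remainder-≤ e p β e≤β)
    ... | no ¬mult = coeff-combination-≰ (cofactors (remainder e p) es) es β ¬mult
  coeff-combination-cofactors (e ∷ es) p β (here e≤β) | no e≰β = contradiction e≤β e≰β
  coeff-combination-cofactors (e ∷ es) p β (there mult) | no e≰β = begin
    coeff (quotient e p *ₚ monomial e ++ combination (cofactors (remainder e p) es) es) β
      ≈⟨ coeff-++ (quotient e p *ₚ monomial e) _ β ⟩
    coeff (quotient e p *ₚ monomial e) β ⊕ coeff (combination (cofactors (remainder e p) es) es) β
      ≈⟨ +-cong (coeff-*monomial-≰ (quotient e p) e β e≰β)
                (coeff-combination-cofactors es (remainder e p) β mult) ⟩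
    0# ⊕ coeff (remainder e p) β
      ≈⟨ ≈-trans (+-identityˡ _) (coeff-remainder-≰ e p β e≰β) ⟩
    coeff p β ∎

  ∈⟨monomials⟩⇔supportedOn : ∀ p es → p ∈⟨ List.map monomial es ⟩ ⇔ SupportedOn (Multiple es) p
  ∈⟨monomials⟩⇔supportedOn p es = mk⇔ supported generated
    where
    supported : p ∈⟨ List.map monomial es ⟩ → SupportedOn (Multiple es) p
    supported (hs , _ , p≈) β ¬mult = ≈-trans (p≈ β) (coeff-combination-≰ hs es β ¬mult)

    generated : SupportedOn (Multiple es) p → p ∈⟨ List.map monomial es ⟩
    generated supp = cofactors p es , length-cofactors p es , p≈
      where
      p≈ : p ≈ₚ combination (cofactors p es) es
      p≈ β with any? (_≤ₑ? β) es
      ... | yes mult = ≈-sym (coeff-combination-cofactors es p β mult)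
      ... | no ¬mult = ≈-trans (supp β ¬mult) (≈-sym (coeff-combination-≰ (cofactors p es) es β ¬mult))

  supportedOn-mono : ∀ {P Q : Exp → Set} p → (∀ β → P β → Q β) → SupportedOn P p → SupportedOn Q p
  supportedOn-mono p P⊆Q supp β ¬Qβ = supp β (¬Qβ ∘ P⊆Q β)

  supportedOn-cong : ∀ {P Q : Exp → Set} p → (∀ β → P β ⇔ Q β) → SupportedOn P p ⇔ SupportedOn Q p
  supportedOn-cong p P⇔Q =
    mk⇔ (supportedOn-mono p (Equivalence.to ∘ P⇔Q)) (supportedOn-mono p (Equivalence.from ∘ P⇔Q))

  supportedOn-*monomial : ∀ (P : Exp → Set) p γ →
                          SupportedOn P (p *ₚ monomial γ) ⇔ SupportedOn (λ β → P (β +ₑ γ)) p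
  supportedOn-*monomial P p γ = mk⇔ shifted unshifted
    where
    shifted : SupportedOn P (p *ₚ monomial γ) → SupportedOn (λ β → P (β +ₑ γ)) p
    shifted supp β ¬P = ≈-trans (≈-sym (coeff-*monomial p γ β)) (supp (β +ₑ γ) ¬P)

    unshifted : SupportedOn (λ β → P (β +ₑ γ)) p → SupportedOn P (p *ₚ monomial γ)
    unshifted supp δ ¬Pδ with γ ≤ₑ? δ
    ... | no  γ≰δ = coeff-*monomial-≰ p γ δ γ≰δ
    ... | yes γ≤δ = begin
      coeff (p *ₚ monomial γ) δ             ≈⟨ reflexive (cong (coeff (p *ₚ monomial γ)) (sym δ≡)) ⟩
      coeff (p *ₚ monomial γ) (δ ∸ₑ γ +ₑ γ) ≈⟨ coeff-*monomial p γ (δ ∸ₑ γ) ⟩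
      coeff p (δ ∸ₑ γ)                      ≈⟨ supp (δ ∸ₑ γ) (¬Pδ ∘ subst P δ≡) ⟩
      0#                                    ∎
      where
      δ≡ : δ ∸ₑ γ +ₑ γ ≡ δ
      δ≡ = m∸ₑn+ₑn≡m γ≤δ

  ∈⟨monomials⟩-mono : ∀ {es es′} → All (_∈ es′) es →
                      ∀ g → g ∈⟨ List.map monomial es ⟩ → g ∈⟨ List.map monomial es′ ⟩
  ∈⟨monomials⟩-mono {es} {es′} es⊆es′ g =
    Equivalence.from (∈⟨monomials⟩⇔supportedOn g es′)
    ∘ supportedOn-mono g (λ _ → Any-resp-⊆ (All.lookup es⊆es′))
    ∘ Equivalence.to (∈⟨monomials⟩⇔supportedOn g es)

  monomial-colon : ∀ γ es ls → (∀ β → Multiple ls β ⇔ Multiple es (β +ₑ γ)) →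
                   ∀ g → g ∈⟨ List.map monomial ls ⟩ ⇔ (g *ₚ monomial γ) ∈⟨ List.map monomial es ⟩
  monomial-colon γ es ls ls⇔es g =
    ⇔.trans (∈⟨monomials⟩⇔supportedOn g ls)
    (⇔.trans (supportedOn-cong g ls⇔es)
    (⇔.trans (⇔.sym (supportedOn-*monomial (Multiple es) g γ))
             (⇔.sym (∈⟨monomials⟩⇔supportedOn (g *ₚ monomial γ) es))))

module StrongShelling {n} (Δ : SimplicialComplex n) {L : List (Subset n)}
                      (shelling : IsStrongShellingOrder Δ L) (j : Fin (length L)) where

  Fⱼ : Subset n
  Fⱼ = lookup L j

  earlier : List (Subset n)
  earlier = take (toℕ j) L

  Adjacent : Subset n → Set
  Adjacent F = ∣ Fⱼ ─ F ∣ ≡ 1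

  adjacent? : Decidable Adjacent
  adjacent? F = ∣ Fⱼ ─ F ∣ ℕ.≟ 1

  adjacent : List (Subset n)
  adjacent = filter adjacent? earlier

  facet : ∀ {F} → F ∈ L → IsFacet Δ F
  facet = Equivalence.to (proj₂ (proj₁ shelling) _)

  earlier-facet : ∀ {F} → F ∈ earlier → IsFacet Δ F
  earlier-facet F∈earlier with ∈-take⇒lookup L (toℕ j) F∈earlier
  ... | i , _ , refl = facet (∈-lookup i)

  adjacent-linear : Pure Δ → ∀ {F} → F ∈ adjacent → ∣ F ─ Fⱼ ∣ ≡ 1
  adjacent-linear pure {F} F∈adjacent with ∈-filter⁻ adjacent? F∈adjacent
  ... | F∈earlier , ∣Fⱼ─F∣≡1 =
    ∣p─q∣≡1⇒∣q─p∣≡1 Fⱼ F (pure F Fⱼ (earlier-facet F∈earlier) (facet (∈-lookup j))) ∣Fⱼ─F∣≡1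

  shifted-divisor⇔adjacent-divisor : ∀ β →
    Any (λ F → χ F ≤ₑ β +ₑ χ Fⱼ) earlier ⇔ Any (λ F → χ (F ─ Fⱼ) ≤ₑ β) adjacent
  shifted-divisor⇔adjacent-divisor β = mk⇔ adjacent-divisor shifted-divisor
    where
    adjacent-divisor : Any (λ F → χ F ≤ₑ β +ₑ χ Fⱼ) earlier → Any (λ F → χ (F ─ Fⱼ) ≤ₑ β) adjacent
    adjacent-divisor divisor with find divisor
    ... | _ , Fᵢ∈earlier , χFᵢ≤ with ∈-take⇒lookup L (toℕ j) Fᵢ∈earlier
    ... | i , i<j , refl with proj₂ shelling i j i<j
    ... | k , k<j , ∣Fⱼ─Fₖ∣≡1 , _ , Fₖ─Fⱼ⊆Fᵢ =
      lose (∈-filter⁺ adjacent? (lookup∈take L (toℕ j) k k<j) ∣Fⱼ─Fₖ∣≡1)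
           (χ-─-≤ₑ (lookup L i) Fⱼ (lookup L k) β Fₖ─Fⱼ⊆Fᵢ χFᵢ≤)

    shifted-divisor : Any (λ F → χ (F ─ Fⱼ) ≤ₑ β) adjacent → Any (λ F → χ F ≤ₑ β +ₑ χ Fⱼ) earlier
    shifted-divisor divisor with find divisor
    ... | F , F∈adjacent , χ[F─Fⱼ]≤β =
      lose (proj₁ (∈-filter⁻ adjacent? F∈adjacent)) (χ-≤ₑ-+ₑχ F Fⱼ β χ[F─Fⱼ]≤β)

module FacetIdeals {c ℓ} (K : Field c ℓ) (n : ℕ) where
  open Field K using (1#)
  open Poly K n
  open MonomialIdeals K n

  xmon≡monomial-χ : ∀ F → xmon F ≡ monomial (χ F)
  xmon≡monomial-χ F = cong (λ e → (1# , e) ∷ []) (Vecₚ.map-cong (λ { true → refl ; false → refl }) F)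

  map-xmon : ∀ Fs → List.map xmon Fs ≡ List.map monomial (List.map χ Fs)
  map-xmon Fs = trans (Listₚ.map-cong xmon≡monomial-χ Fs) (Listₚ.map-∘ Fs)

  xmon-homogeneous : ∀ Fs → All IsHomogeneous (List.map xmon Fs)
  xmon-homogeneous Fs = Allₚ.map⁺ (All.universal homogeneous Fs)
    where
    homogeneous : ∀ F → IsHomogeneous (xmon F)
    homogeneous F = subst IsHomogeneous (sym (xmon≡monomial-χ F)) (monomial-homogeneous (χ F))

  facetIdeal-generated : ∀ Δ {L} → IsFacetOrder Δ L → ∀ g → g ∈⟨ List.map xmon L ⟩ ⇔ InFacetIdeal Δ g
  facetIdeal-generated Δ {L} (_ , ∈L⇔facet) g = mk⇔ (λ g∈ → L , facets-L , g∈) from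
    where
    facets-L : All (IsFacet Δ) L
    facets-L = All.tabulate (Equivalence.to (∈L⇔facet _))

    from : InFacetIdeal Δ g → g ∈⟨ List.map xmon L ⟩
    from (Fs , facets , g∈) rewrite map-xmon L | map-xmon Fs =
      ∈⟨monomials⟩-mono (Allₚ.map⁺ (All.map (∈-map⁺ χ ∘ Equivalence.from (∈L⇔facet _)) facets)) g g∈

  HasLinearColon : List Pol → Pol → Set (c ⊔ ℓ)
  HasLinearColon fs f = ∃[ ls ] (All IsLinearForm ls × (∀ g → (g ∈⟨ ls ⟩) ⇔ ((g *ₚ f) ∈⟨ fs ⟩)))

  strong-shelling-linear-colon : ∀ Δ {L} → Pure Δ → IsStrongShellingOrder Δ L → (j : Fin (length L)) →
                                 HasLinearColon (List.map xmon (take (toℕ j) L)) (xmon (lookup L j))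
  strong-shelling-linear-colon Δ pure shelling j = List.map monomial generators , linear , colon
    where
    open StrongShelling Δ shelling j

    generators : List Exp
    generators = List.map (χ ∘ (_─ Fⱼ)) adjacent

    linear : All IsLinearForm (List.map monomial generators)
    linear = Allₚ.map⁺ (Allₚ.map⁺ (All.tabulate (λ {F} F∈adjacent →
      monomial-linear (χ (F ─ Fⱼ)) (trans (sum-χ (F ─ Fⱼ)) (adjacent-linear pure F∈adjacent)))))

    generators⇔shifted : ∀ β → Multiple generators β ⇔ Multiple (List.map χ earlier) (β +ₑ χ Fⱼ)
    generators⇔shifted β = mk⇔
      (Anyₚ.map⁺ ∘ Equivalence.from (shifted-divisor⇔adjacent-divisor β) ∘ Anyₚ.map⁻)
      (Anyₚ.map⁺ ∘ Equivalence.to (shifted-divisor⇔adjacent-divisor β) ∘ Anyₚ.map⁻)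

    colon : ∀ g → g ∈⟨ List.map monomial generators ⟩ ⇔ (g *ₚ xmon Fⱼ) ∈⟨ List.map xmon earlier ⟩
    colon rewrite xmon≡monomial-χ Fⱼ | map-xmon earlier =
      monomial-colon (χ Fⱼ) (List.map χ earlier) generators generators⇔shifted

  strong-shelling-linear-quotients : ∀ Δ {L} → Pure Δ → IsStrongShellingOrder Δ L →
    (i : Fin (length (List.map xmon L))) →
    HasLinearColon (take (toℕ i) (List.map xmon L)) (lookup (List.map xmon L) i)
  strong-shelling-linear-quotients Δ {L} pure shelling i with lookup-map xmon L i
  ... | j , j≡i , Lᵢ≡ rewrite Lᵢ≡ | Listₚ.take-map {f = xmon} (toℕ i) L | sym j≡i =
    strong-shelling-linear-colon Δ pure shelling j

theorem4p11 : ∀ {c ℓ : Level} (K : Field c ℓ) (n : ℕ) (Δ : SimplicialComplex n) →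
              Pure Δ → StronglyShellable Δ →
              Poly.HasLinearQuotients K n (Poly.InFacetIdeal K n Δ)
theorem4p11 K n Δ pure (L , shelling) =
  List.map xmon L , xmon-homogeneous L , facetIdeal-generated Δ (proj₁ shelling) ,
  strong-shelling-linear-quotients Δ pure shelling
  where
  open Poly K n using (xmon)
  open FacetIdeals K n
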